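{- Let $\ell\geq1$ and $m\geq0$, and let $X\subseteq\mathbb{N}$ be a finite $\omega^{m+3}$-large set with $3\ell+2\leq\min X$. Then $X$ has a subset which is $\omega^2\cdot3$-sparse and $(\omega^m\cdot\ell+1)$-large.
   Context: A set $X\subseteq\mathbb{N}$ is $\alpha$-sparse if for all $x<y$ in $X$ the interval $(x,y]\cap\mathbb{N}$ is $\alpha$-large. Fundamental sequences: $\{0\}(x)=0$; for $\alpha\neq0$ write $\alpha=\delta+\omega^\gamma$ in Cantor normal form with $\omega^\gamma$ the last term; $\{\alpha\}(x)=\delta$ if $\gamma=0$, $\delta+\omega^{\gamma'}\cdot x$ if $\gamma=\gamma'+1$, $\delta+\omega^{\{\gamma\}(x)}$ if $\gamma$ is a limit. For finite $X=\{x_0<\dots<x_s\}$, $\{\alpha\}(X)=\{\cdots\{\{\alpha\}(x_0)\}(x_1)\cdots\}(x_s)$ and $X$ is $\alpha$-large iff $\{\alpha\}(X)=0$. -}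

module Defs where

open import Data.Nat using (ℕ; zero; suc; _+_; _∸_; _<_)
open import Data.List using (List; []; _∷_; map; upTo)
open import Data.List.Membership.Propositional using (_∈_)
open import Relation.Binary.PropositionalEquality using (_≡_)

-- Ordinals below ε₀ in Cantor normal form, written with their LAST term
-- explicit:  O0 is 0, and  δ ⊕ω^ γ  denotes  δ + ω^γ.
-- (Well-formedness, i.e. non-increasing exponents, is not enforced by the
-- type; all ordinals used in the statement are built in normal form.)
infixl 6 _⊕ω^_
data Ord : Set where
  O0     : Ord
  _⊕ω^_  : Ord → Ord → Ord

addCopies : Ord → Ord → ℕ → Ord
addCopies δ γ zero    = δ
addCopies δ γ (suc x) = addCopies δ γ x ⊕ω^ γ

fs : Ord → ℕ → Ord
fs O0                         x = O0
fs (δ ⊕ω^ O0)                 x = δ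
fs (δ ⊕ω^ (γ' ⊕ω^ O0))        x = addCopies δ γ' x          -- γ = γ' + 1
fs (δ ⊕ω^ (γ₁ ⊕ω^ (γ₂ ⊕ω^ γ₃))) x = δ ⊕ω^ fs (γ₁ ⊕ω^ (γ₂ ⊕ω^ γ₃)) x  -- γ limit

-- {α}(X) for X = x₀ < ... < x_s given as an increasing list
fsSet : Ord → List ℕ → Ord
fsSet α []       = α
fsSet α (x ∷ xs) = fsSet (fs α x) xs

Large : Ord → List ℕ → Set
Large α X = fsSet α X ≡ O0

interval : ℕ → ℕ → List ℕ
interval x y = map (λ i → suc x + i) (upTo (y ∸ x))

Sparse : Ord → List ℕ → Set
Sparse α X = ∀ x y → x ∈ X → y ∈ X → x < y → Large α (interval x y)

natO : ℕ → Ord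
natO n = addCopies O0 O0 n

ω^ : Ord → Ord
ω^ γ = O0 ⊕ω^ γ

ωmul : Ord → ℕ → Ord
ωmul γ n = addCopies O0 γ n

{-# OPTIONS --safe #-}
module Submission where

-- Write X = x ∷ X′; then X′ is ω^(m+2)·x-large and x > 3ℓ. Ordinals below ω^ω
-- are handled as coefficient vectors. The sparse set is chosen greedily: if p is
-- the last chosen point and G is the initial segment of the remaining elements
-- that is exactly ω²·3-large, then G ⊆ (p, max G], so (p, max G] is ω²·3-large
-- and max G is chosen next. Each ω^(j+2)·3 of the budget pays for one ω^j of the
-- chosen set: after choosing y, one ω^(j+3)·3 may be traded for ω^(j+2)·3·(y+1),
-- as all later elements exceed y, and this pays for a chosen set that is exactly
-- ω^j·y-large, which is what {ω^(j+1)}(y) = ω^j·y asks for. A trailing ω²·3 in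
-- the budget pays for each next choice. Starting from p = x, the chosen set Y
-- is exactly ω^m·ℓ-large, so x ∷ Y is the required subset.

open import Defs
open import Data.Nat using (ℕ; _+_; _*_; _≤_; _<_)
open import Data.Product using (Σ; _×_)
open import Data.List using (List)
open import Data.List.Relation.Unary.All using (All)
open import Data.List.Relation.Unary.AllPairs using (AllPairs)
open import Data.List.Relation.Binary.Sublist.Propositional using (_⊆_)

open import Data.Empty using (⊥-elim)
open import Data.List using ([]; _∷_; _++_; applyUpTo; initLast; _∷ʳ′_)
open import Data.List.Membership.Propositional using (_∈_)
open import Data.List.Properties using (map-upTo; ++-assoc)
open import Data.List.Relation.Binary.Sublist.Propositional using ([]; _∷_; _∷ʳ_; ⊆-refl; ⊆-trans)
open import Data.List.Relation.Binary.Sublist.Propositional.Properties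
  using (All-resp-⊆; ++⁺ˡ; ++⁺ʳ; ++⁺; []⊆-universal)
open import Data.List.Relation.Unary.All using ([]; _∷_)
import Data.List.Relation.Unary.All as All
open import Data.List.Relation.Unary.All.Properties using (∷ʳ⁻)
open import Data.List.Relation.Unary.AllPairs using ([]; _∷_)
import Data.List.Relation.Unary.AllPairs as AllPairs
open import Data.List.Relation.Unary.Any using (here; there)
open import Data.Nat using (zero; suc; _∸_; z≤n; s≤s; _≟_)
open import Data.Nat.Properties
open import Data.Product using (proj₁; proj₂; _,_)
open import Data.Sum using (inj₁; inj₂)
open import Data.Vec using (Vec; []; _∷_; replicate; zipWith)
open import Data.Vec.Properties
  using (∷-injective; zipWith-assoc; zipWith-identityˡ; zipWith-identityʳ; ≡-dec)
open import Data.Vec.Relation.Binary.Pointwise.Inductive using (Pointwise-≡⇒≡; zipWith-comm)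
open import Relation.Binary.Construct.Closure.Reflexive as ReflClosure using (ReflClosure; refl; [_])
import Relation.Binary.Construct.Closure.Reflexive.Properties as ReflClosureₚ
open import Relation.Binary.Core using (Rel)
open import Relation.Binary.PropositionalEquality
  using (_≡_; _≢_; refl; sym; trans; cong; cong₂; subst; module ≡-Reasoning)
open import Relation.Nullary using (¬_; yes; no)
open ≡-Reasoning

-- Ordinals below ω^ω as coefficient vectors

-- (c₀, …, cₙ₋₁) stands for ω^(n-1)·cₙ₋₁ + ⋯ + ω⁰·c₀: lowest exponent first.
CNF : ℕ → Set
CNF = Vec ℕ

private variable
  n N k b c x y p q r : ℕ
  α : Ord
  u v w γ δ : CNF n
  X Y Y′ A B X₁ X₂ : List ℕ

𝟎 : CNF n
𝟎 = replicate _ 0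

fsᶜ₀ : CNF n → ℕ → CNF (suc n)
fsᶜ₀ []          x = 𝟎
fsᶜ₀ (suc d ∷ v) x = x ∷ d ∷ v
fsᶜ₀ (zero ∷ v)  x = 0 ∷ fsᶜ₀ v x

fsᶜ : CNF n → ℕ → CNF n
fsᶜ []          x = []
fsᶜ (suc c ∷ v) x = c ∷ v
fsᶜ (zero ∷ v)  x = fsᶜ₀ v x

fsSetᶜ : CNF n → List ℕ → CNF n
fsSetᶜ v []      = v
fsSetᶜ v (x ∷ X) = fsSetᶜ (fsᶜ v x) X

Largeᶜ : CNF n → List ℕ → Set
Largeᶜ v X = fsSetᶜ v X ≡ 𝟎

-- ω^[ k ]· c collapses to 𝟎 when k ≥ n.
ω^[_]·_ : ℕ → ℕ → CNF n
ω^[_]·_ {zero}  k       c = []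
ω^[_]·_ {suc n} zero    c = c ∷ 𝟎
ω^[_]·_ {suc n} (suc k) c = 0 ∷ ω^[ k ]· c

infixl 6 _⊕_
_⊕_ : CNF n → CNF n → CNF n
_⊕_ = zipWith _+_

⊕-identityˡ : ∀ (v : CNF n) → 𝟎 ⊕ v ≡ v
⊕-identityˡ = zipWith-identityˡ +-identityˡ

⊕-identityʳ : ∀ (v : CNF n) → v ⊕ 𝟎 ≡ v
⊕-identityʳ = zipWith-identityʳ +-identityʳ

⊕-assoc : ∀ (u v w : CNF n) → u ⊕ v ⊕ w ≡ u ⊕ (v ⊕ w)
⊕-assoc = zipWith-assoc +-assoc

⊕-comm : ∀ (u v : CNF n) → u ⊕ v ≡ v ⊕ u
⊕-comm u v = Pointwise-≡⇒≡ (zipWith-comm +-comm u v)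

⊕-right-comm : ∀ (u v w : CNF n) → u ⊕ v ⊕ w ≡ u ⊕ w ⊕ v
⊕-right-comm u v w = trans (⊕-assoc u v w) (trans (cong (u ⊕_) (⊕-comm v w)) (sym (⊕-assoc u w v)))

u⊕v≡𝟎⇒v≡𝟎 : ∀ (u v : CNF n) → u ⊕ v ≡ 𝟎 → v ≡ 𝟎
u⊕v≡𝟎⇒v≡𝟎 []      []      _  = refl
u⊕v≡𝟎⇒v≡𝟎 (a ∷ u) (c ∷ v) eq =
  cong₂ _∷_ (m+n≡0⇒n≡0 a (proj₁ (∷-injective eq))) (u⊕v≡𝟎⇒v≡𝟎 u v (proj₂ (∷-injective eq)))

ω^-0 : ∀ n k → ω^[ k ]· 0 ≡ 𝟎 {n}
ω^-0 zero    k       = refl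
ω^-0 (suc n) zero    = refl
ω^-0 (suc n) (suc k) = cong (0 ∷_) (ω^-0 n k)

ω^-+ : ∀ n k a c → ω^[_]·_ {n} k (a + c) ≡ ω^[ k ]· a ⊕ ω^[ k ]· c
ω^-+ zero    k       a c = refl
ω^-+ (suc n) zero    a c = cong ((a + c) ∷_) (sym (⊕-identityˡ 𝟎))
ω^-+ (suc n) (suc k) a c = cong (0 ∷_) (ω^-+ n k a c)

⊕ω^-+ : ∀ (δ : CNF n) k a c → δ ⊕ ω^[ k ]· (a + c) ≡ δ ⊕ ω^[ k ]· a ⊕ ω^[ k ]· c
⊕ω^-+ {n} δ k a c = trans (cong (δ ⊕_) (ω^-+ n k a c)) (sym (⊕-assoc δ _ _))

⊕ω^-3*suc : ∀ (δ : CNF n) k c → δ ⊕ ω^[ k ]· (3 * suc c) ≡ δ ⊕ ω^[ k ]· (3 * c) ⊕ ω^[ k ]· 3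
⊕ω^-3*suc δ k c =
  trans (cong (λ e → δ ⊕ ω^[ k ]· e) (trans (*-suc 3 c) (+-comm 3 (3 * c)))) (⊕ω^-+ δ k (3 * c) 3)

ω^≢𝟎 : k < n → ω^[ k ]· suc c ≢ 𝟎 {n}
ω^≢𝟎 {zero}  {suc n} _         ()
ω^≢𝟎 {suc k} {suc n} (s≤s k<n) eq = ω^≢𝟎 k<n (proj₂ (∷-injective eq))

fsᶜ-ω^suc : suc k < n → fsᶜ {n} (ω^[ suc k ]· suc c) x ≡ ω^[ suc k ]· c ⊕ ω^[ k ]· x
fsᶜ-ω^suc {zero}  {suc (suc n)} {c} {x} (s≤s (s≤s _)) =
  cong (x ∷_) (sym (cong₂ _∷_ (+-identityʳ c) (⊕-identityˡ 𝟎)))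
fsᶜ-ω^suc {suc k} {suc (suc n)} (s≤s k<n) = cong (0 ∷_) (fsᶜ-ω^suc k<n)

toOrd : ℕ → CNF n → Ord
toOrd i []      = O0
toOrd i (c ∷ v) = addCopies (toOrd (suc i) v) (natO i) c

⟦_⟧ : CNF n → Ord
⟦_⟧ = toOrd 0

fs-toOrd₀ : ∀ i (v : CNF n) x → fs (toOrd i (0 ∷ v)) x ≡ toOrd i (fsᶜ₀ v x)
fs-toOrd₀ i []          x = refl
fs-toOrd₀ i (suc d ∷ v) x = refl
fs-toOrd₀ i (zero ∷ v)  x = fs-toOrd₀ (suc i) v x

fs-⟦⟧ : ∀ (v : CNF n) x → fs ⟦ v ⟧ x ≡ ⟦ fsᶜ v x ⟧
fs-⟦⟧ []          x = refl
fs-⟦⟧ (suc c ∷ v) x = refl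
fs-⟦⟧ (zero ∷ v)  x = fs-toOrd₀ 0 v x

fsSet-⟦⟧ : ∀ (v : CNF n) X → fsSet ⟦ v ⟧ X ≡ ⟦ fsSetᶜ v X ⟧
fsSet-⟦⟧ v []      = refl
fsSet-⟦⟧ v (x ∷ X) = trans (cong (λ α → fsSet α X) (fs-⟦⟧ v x)) (fsSet-⟦⟧ (fsᶜ v x) X)

toOrd-𝟎 : ∀ n i → toOrd i (𝟎 {n}) ≡ O0
toOrd-𝟎 zero    i = refl
toOrd-𝟎 (suc n) i = toOrd-𝟎 n (suc i)

toOrd≡O0⇒𝟎 : ∀ i (v : CNF n) → toOrd i v ≡ O0 → v ≡ 𝟎
toOrd≡O0⇒𝟎 i []          eq = refl
toOrd≡O0⇒𝟎 i (zero ∷ v)  eq = cong (0 ∷_) (toOrd≡O0⇒𝟎 (suc i) v eq)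
toOrd≡O0⇒𝟎 i (suc c ∷ v) ()

toOrd-ω^ : ∀ i → k < n → toOrd i (ω^[_]·_ {n} k c) ≡ ωmul (natO (k + i)) c
toOrd-ω^ {zero}  {suc n} {c} i _ = cong (λ α → addCopies α (natO i) c) (toOrd-𝟎 n (suc i))
toOrd-ω^ {suc k} {suc n} {c} i (s≤s k<n) =
  trans (toOrd-ω^ (suc i) k<n) (cong (λ e → ωmul (natO e) c) (+-suc k i))

⟦ω^⟧ : k < n → ⟦ ω^[_]·_ {n} k c ⟧ ≡ ωmul (natO k) c
⟦ω^⟧ {k} {c = c} k<n = trans (toOrd-ω^ 0 k<n) (cong (λ e → ωmul (natO e) c) (+-identityʳ k))

Largeᶜ⇒Large : ∀ (v : CNF n) X → Largeᶜ v X → Large ⟦ v ⟧ X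
Largeᶜ⇒Large {n} v X L = trans (fsSet-⟦⟧ v X) (trans (cong ⟦_⟧ L) (toOrd-𝟎 n 0))

Large⇒Largeᶜ : ∀ (v : CNF n) X → Large ⟦ v ⟧ X → Largeᶜ v X
Large⇒Largeᶜ v X L = toOrd≡O0⇒𝟎 0 (fsSetᶜ v X) (trans (sym (fsSet-⟦⟧ v X)) L)

Large-ω^suc⇒Largeᶜ : ∀ x X → k < n → Large (ω^ (natO (suc k))) (x ∷ X) → Largeᶜ (ω^[_]·_ {n} k x) X
Large-ω^suc⇒Largeᶜ {k} x X k<n L =
  Large⇒Largeᶜ (ω^[ k ]· x) X (subst (λ α → Large α X) (sym (⟦ω^⟧ k<n)) L)

-- Monotonicity of largeness

-- u ≺[ b ] w: u is lexicographically below w, and the coefficients of u below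
-- the highest position where they differ are all < b.
infix 4 _≺[_]_ _≼[_]_
data _≺[_]_ : CNF n → ℕ → CNF n → Set where
  here  : ∀ {a c} → a < c → (a ∷ v) ≺[ b ] (c ∷ v)
  there : ∀ {a c} → u ≺[ b ] w → a < b → (a ∷ u) ≺[ b ] (c ∷ w)

_≼[_]_ : CNF n → ℕ → CNF n → Set
u ≼[ b ] w = ReflClosure (_≺[ b ]_) u w

≺-weaken : ∀ {b′} → b ≤ b′ → u ≺[ b ] w → u ≺[ b′ ] w
≺-weaken b≤b′ (here a<c)      = here a<c
≺-weaken b≤b′ (there u≺w a<b) = there (≺-weaken b≤b′ u≺w) (<-≤-trans a<b b≤b′)

≼-weaken : ∀ {b′} → b ≤ b′ → u ≼[ b ] w → u ≼[ b′ ] w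
≼-weaken b≤b′ = ReflClosure.map (≺-weaken b≤b′)

≺-trans : ∀ {v} → u ≺[ b ] v → v ≺[ b ] w → u ≺[ b ] w
≺-trans (here a<b)     (here b<c)     = here (<-trans a<b b<c)
≺-trans (here a<b)     (there v≺w b<) = there v≺w (<-trans a<b b<)
≺-trans (there u≺v a<) (here _)       = there u≺v a<
≺-trans (there u≺v a<) (there v≺w _)  = there (≺-trans u≺v v≺w) a<

≼-trans : ∀ {v} → u ≼[ b ] v → v ≼[ b ] w → u ≼[ b ] w
≼-trans = ReflClosureₚ.trans ≺-trans

¬≺𝟎 : ¬ (u ≺[ b ] 𝟎)
¬≺𝟎 (there u≺𝟎 _) = ¬≺𝟎 u≺𝟎

≺-pred : u ≺[ b ] (suc c ∷ w) → u ≼[ b ] (c ∷ w)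
≺-pred (here (s≤s a≤c)) with m≤n⇒m<n∨m≡n a≤c
... | inj₁ a<c  = [ here a<c ]
... | inj₂ refl = refl
≺-pred (there u≺w a<b) = [ there u≺w a<b ]

fsᶜ₀-≼ : ∀ (v : CNF n) → x < b → fsᶜ₀ v x ≼[ b ] (0 ∷ v)
fsᶜ₀-≼ []          x<b = refl
fsᶜ₀-≼ (suc d ∷ v) x<b = [ there (here ≤-refl) x<b ]
fsᶜ₀-≼ (zero ∷ v)  x<b = ReflClosure.map (λ lt → there lt (≤-<-trans z≤n x<b)) (fsᶜ₀-≼ v x<b)

fsᶜ-≼ : ∀ (v : CNF n) → x < b → fsᶜ v x ≼[ b ] v
fsᶜ-≼ []          x<b = refl
fsᶜ-≼ (suc c ∷ v) x<b = [ here ≤-refl ]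
fsᶜ-≼ (zero ∷ v)  x<b = fsᶜ₀-≼ v x<b

≺-fsᶜ₀ : ∀ {a} → u ≺[ x ] w → a < x → (a ∷ u) ≺[ x ] fsᶜ₀ w x
≺-fsᶜ₀ {w = suc c ∷ w} u≺w a<x with ≺-pred u≺w
... | refl   = here a<x
... | [ lt ] = there lt a<x
≺-fsᶜ₀ {w = zero ∷ w} (there u≺w a′<x) a<x = there (≺-fsᶜ₀ u≺w a′<x) a<x

≺-fsᶜ : u ≺[ x ] w → u ≼[ x ] fsᶜ w x
≺-fsᶜ {w = suc c ∷ w} u≺w             = ≺-pred u≺w
≺-fsᶜ {w = zero ∷ w}  (there u≺w a<x) = [ ≺-fsᶜ₀ u≺w a<x ]

fsᶜ-mono-≼ : b ≤ x → u ≼[ b ] w → fsᶜ u x ≼[ suc x ] fsᶜ w x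
fsᶜ-mono-≼ b≤x refl = refl
fsᶜ-mono-≼ {u = u} b≤x [ u≺w ] =
  ≼-trans (fsᶜ-≼ u ≤-refl) (≼-weaken (n≤1+n _) (≺-fsᶜ (≺-weaken b≤x u≺w)))

large-mono : A ⊆ B → AllPairs _<_ B → All (b ≤_) B → u ≼[ b ] w → Largeᶜ w A → Largeᶜ u B
large-mono []           []         []          refl    L    = L
large-mono []           []         []          [ u≺𝟎 ] refl = ⊥-elim (¬≺𝟎 u≺𝟎)
large-mono {u = u} (x ∷ʳ A⊆B) (x<B ∷ B↑) (b≤x ∷ _) u≼w L =
  large-mono A⊆B B↑ x<B (≼-trans (fsᶜ-≼ u ≤-refl) (≼-weaken (m≤n⇒m≤1+n b≤x) u≼w)) L
large-mono (refl ∷ A⊆B) (x<B ∷ B↑) (b≤x ∷ _) u≼w L =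
  large-mono A⊆B B↑ x<B (fsᶜ-mono-≼ b≤x u≼w) L

large-⊆ : A ⊆ B → AllPairs _<_ B → Largeᶜ v A → Largeᶜ v B
large-⊆ A⊆B B↑ = large-mono A⊆B B↑ (All.universal (λ _ → z≤n) _) refl

large-≼ : AllPairs _<_ (y ∷ X) → u ≼[ suc y ] w → Largeᶜ w X → Largeᶜ u X
large-≼ (y<X ∷ X↑) = large-mono ⊆-refl X↑ y<X

AllPairs-resp-⊆ : ∀ {ℓ} {R : Rel ℕ ℓ} → A ⊆ B → AllPairs R B → AllPairs R A
AllPairs-resp-⊆ []           []         = []
AllPairs-resp-⊆ (_ ∷ʳ A⊆B)   (_ ∷ B↑)   = AllPairs-resp-⊆ A⊆B B↑
AllPairs-resp-⊆ (refl ∷ A⊆B) (x≺B ∷ B↑) = All-resp-⊆ A⊆B x≺B ∷ AllPairs-resp-⊆ A⊆B B↑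

-- Ordinal sums

data ZeroBelow : ℕ → CNF n → Set where
  base : ZeroBelow 0 v
  []   : ZeroBelow (suc k) []
  0∷_  : ZeroBelow k v → ZeroBelow (suc k) (0 ∷ v)

data ZeroAbove : ℕ → CNF n → Set where
  []   : ZeroAbove k []
  top  : ∀ {a} → ZeroAbove 0 (a ∷ 𝟎 {n})
  next : ∀ {a} → ZeroAbove k v → ZeroAbove (suc k) (a ∷ v)

zeroBelow-𝟎 : ∀ n k → ZeroBelow k (𝟎 {n})
zeroBelow-𝟎 n       zero    = base
zeroBelow-𝟎 zero    (suc k) = []
zeroBelow-𝟎 (suc n) (suc k) = 0∷ zeroBelow-𝟎 n k

zeroBelow-weaken : ∀ {k′} → k ≤ k′ → ZeroBelow k′ v → ZeroBelow k v
zeroBelow-weaken z≤n        _      = base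
zeroBelow-weaken (s≤s k≤k′) []     = []
zeroBelow-weaken (s≤s k≤k′) (0∷ z) = 0∷ zeroBelow-weaken k≤k′ z

zeroBelow-⊕ : ZeroBelow k u → ZeroBelow k v → ZeroBelow k (u ⊕ v)
zeroBelow-⊕ base   _       = base
zeroBelow-⊕ []     []      = []
zeroBelow-⊕ (0∷ z) (0∷ z′) = 0∷ zeroBelow-⊕ z z′

zeroBelow-ω^ : ∀ {k′} → k ≤ k′ → ZeroBelow k (ω^[_]·_ {n} k′ c)
zeroBelow-ω^             z≤n        = base
zeroBelow-ω^ {n = zero}  (s≤s k≤k′) = []
zeroBelow-ω^ {n = suc n} (s≤s k≤k′) = 0∷ zeroBelow-ω^ k≤k′

zeroBelow-⊕ω^ : ∀ {k′} → ZeroBelow k δ → k ≤ k′ → ZeroBelow k (δ ⊕ ω^[ k′ ]· c)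
zeroBelow-⊕ω^ zb k≤k′ = zeroBelow-⊕ zb (zeroBelow-ω^ k≤k′)

zeroAbove-𝟎 : ∀ n k → ZeroAbove k (𝟎 {n})
zeroAbove-𝟎 zero    k       = []
zeroAbove-𝟎 (suc n) zero    = top
zeroAbove-𝟎 (suc n) (suc k) = next (zeroAbove-𝟎 n k)

zeroAbove-ω^ : ∀ {k′} → k′ ≤ k → ZeroAbove k (ω^[_]·_ {n} k′ c)
zeroAbove-ω^ {k}     {zero}  _          = []
zeroAbove-ω^ {zero}  {suc n} z≤n        = top
zeroAbove-ω^ {suc k} {suc n} z≤n        = next (zeroAbove-𝟎 n k)
zeroAbove-ω^ {suc k} {suc n} (s≤s k′≤k) = next (zeroAbove-ω^ k′≤k)

zeroAbove-head : ∀ {a a′} → ZeroAbove k (a ∷ v) → ZeroAbove k (a′ ∷ v)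
zeroAbove-head top      = top
zeroAbove-head (next z) = next z

fsᶜ₀-𝟎 : ∀ n x → fsᶜ₀ (𝟎 {n}) x ≡ 𝟎
fsᶜ₀-𝟎 zero    x = refl
fsᶜ₀-𝟎 (suc n) x = cong (0 ∷_) (fsᶜ₀-𝟎 n x)

zeroAbove-fsᶜ₀ : ∀ (v : CNF n) → ZeroAbove k (0 ∷ v) → ZeroAbove k (fsᶜ₀ v x)
zeroAbove-fsᶜ₀ {n} {x = x} v  top      = subst (ZeroAbove 0) (sym (fsᶜ₀-𝟎 n x)) top
zeroAbove-fsᶜ₀ []             (next z) = next []
zeroAbove-fsᶜ₀ (suc d ∷ v)    (next z) = next (zeroAbove-head z)
zeroAbove-fsᶜ₀ (zero ∷ v)     (next z) = next (zeroAbove-fsᶜ₀ v z)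

zeroAbove-fsᶜ : ∀ (v : CNF n) → ZeroAbove k v → ZeroAbove k (fsᶜ v x)
zeroAbove-fsᶜ []          z = z
zeroAbove-fsᶜ (suc c ∷ v) z = zeroAbove-head z
zeroAbove-fsᶜ (zero ∷ v)  z = zeroAbove-fsᶜ₀ v z

-- Under these hypotheses δ ⊕ γ is the ordinal sum δ + γ, whose fundamental
-- sequence only acts on γ.
fsᶜ₀-⊕ : ∀ (δ γ : CNF n) → ZeroBelow k δ → ZeroAbove k γ → γ ≢ 𝟎
       → fsᶜ₀ (δ ⊕ γ) x ≡ (0 ∷ δ) ⊕ fsᶜ₀ γ x
fsᶜ₀-⊕ []      []          _      _         γ≢𝟎 = ⊥-elim (γ≢𝟎 refl)
fsᶜ₀-⊕ (d ∷ δ) (suc e ∷ γ) _      _         _   rewrite +-suc d e = refl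
fsᶜ₀-⊕ (d ∷ δ) (zero ∷ γ)  base   top       γ≢𝟎 = ⊥-elim (γ≢𝟎 refl)
fsᶜ₀-⊕ (_ ∷ δ) (zero ∷ γ)  (0∷ z) (next z′) γ≢𝟎 =
  cong (0 ∷_) (fsᶜ₀-⊕ δ γ z z′ (λ γ≡𝟎 → γ≢𝟎 (cong (0 ∷_) γ≡𝟎)))

fsᶜ-⊕ : ∀ (δ γ : CNF n) → ZeroBelow k δ → ZeroAbove k γ → γ ≢ 𝟎
      → fsᶜ (δ ⊕ γ) x ≡ δ ⊕ fsᶜ γ x
fsᶜ-⊕ []      []          _      _         _   = refl
fsᶜ-⊕ (d ∷ δ) (suc c ∷ γ) _      _         _   rewrite +-suc d c = refl
fsᶜ-⊕ (d ∷ δ) (zero ∷ γ)  base   top       γ≢𝟎 = ⊥-elim (γ≢𝟎 refl)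
fsᶜ-⊕ (_ ∷ δ) (zero ∷ γ)  (0∷ z) (next z′) γ≢𝟎 =
  fsᶜ₀-⊕ δ γ z z′ (λ γ≡𝟎 → γ≢𝟎 (cong (0 ∷_) γ≡𝟎))

fsᶜ-⊕ω^suc : ∀ (δ : CNF n) → ZeroBelow (suc k) δ → suc k < n
           → fsᶜ (δ ⊕ ω^[ suc k ]· suc c) x ≡ δ ⊕ ω^[ suc k ]· c ⊕ ω^[ k ]· x
fsᶜ-⊕ω^suc {k = k} {c = c} {x} δ zb k<n = begin
  fsᶜ (δ ⊕ ω^[ suc k ]· suc c) x     ≡⟨ fsᶜ-⊕ δ _ zb (zeroAbove-ω^ ≤-refl) (ω^≢𝟎 k<n) ⟩
  δ ⊕ fsᶜ (ω^[ suc k ]· suc c) x     ≡⟨ cong (δ ⊕_) (fsᶜ-ω^suc k<n) ⟩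
  δ ⊕ (ω^[ suc k ]· c ⊕ ω^[ k ]· x)  ≡⟨ ⊕-assoc δ _ _ ⟨
  δ ⊕ ω^[ suc k ]· c ⊕ ω^[ k ]· x    ∎

data ExactlyLarge : CNF n → List ℕ → Set where
  done : ExactlyLarge (𝟎 {n}) []
  step : γ ≢ 𝟎 → ExactlyLarge (fsᶜ γ x) X → ExactlyLarge γ (x ∷ X)

exact⇒large : ExactlyLarge γ X → Largeᶜ γ X
exact⇒large done       = refl
exact⇒large (step _ e) = exact⇒large e

data Split (γ δ : CNF n) : List ℕ → Set where
  split : ExactlyLarge γ X₁ → Largeᶜ δ X₂ → Split γ δ (X₁ ++ X₂)

split-large : ∀ (δ γ : CNF n) X → ZeroBelow k δ → ZeroAbove k γ → Largeᶜ (δ ⊕ γ) X → Split γ δ X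
split-large δ γ X zb za L with ≡-dec _≟_ γ 𝟎
... | yes refl = split done (subst (λ v → Largeᶜ v X) (⊕-identityʳ δ) L)
split-large δ γ []      zb za L | no γ≢𝟎 = ⊥-elim (γ≢𝟎 (u⊕v≡𝟎⇒v≡𝟎 δ γ L))
split-large δ γ (x ∷ X) zb za L | no γ≢𝟎
  with split-large δ (fsᶜ γ x) X zb (zeroAbove-fsᶜ γ za)
         (subst (λ v → Largeᶜ v X) (fsᶜ-⊕ δ γ zb za γ≢𝟎) L)
... | split exact L₂ = split (step γ≢𝟎 exact) L₂

merge-large : ∀ (δ γ : CNF n) → ZeroBelow k δ → ZeroAbove k γ
            → ExactlyLarge γ X₁ → Largeᶜ δ X₂ → Largeᶜ (δ ⊕ γ) (X₁ ++ X₂)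
merge-large {X₂ = X₂} δ γ zb za done L =
  subst (λ v → Largeᶜ v X₂) (sym (⊕-identityʳ δ)) L
merge-large {X₁ = x ∷ X₁} {X₂} δ γ zb za (step γ≢𝟎 exact) L =
  subst (λ v → Largeᶜ v (X₁ ++ X₂)) (sym (fsᶜ-⊕ δ γ zb za γ≢𝟎))
    (merge-large δ (fsᶜ γ x) zb (zeroAbove-fsᶜ γ za) exact L)

exact-++ : ∀ (δ γ : CNF n) → ZeroBelow k δ → ZeroAbove k γ
         → ExactlyLarge γ A → ExactlyLarge δ B → ExactlyLarge (δ ⊕ γ) (A ++ B)
exact-++ {B = B} δ γ zb za done exactδ =
  subst (λ v → ExactlyLarge v B) (sym (⊕-identityʳ δ)) exactδ
exact-++ {A = x ∷ A} {B} δ γ zb za (step γ≢𝟎 exactγ) exactδ =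
  step (λ δ⊕γ≡𝟎 → γ≢𝟎 (u⊕v≡𝟎⇒v≡𝟎 δ γ δ⊕γ≡𝟎))
    (subst (λ v → ExactlyLarge v (A ++ B)) (sym (fsᶜ-⊕ δ γ zb za γ≢𝟎))
      (exact-++ δ (fsᶜ γ x) zb (zeroAbove-fsᶜ γ za) exactγ exactδ))

⊕-monoʳ-≺ : ZeroBelow k δ → ZeroAbove k w → u ≺[ b ] w → δ ⊕ u ≺[ b ] δ ⊕ w
⊕-monoʳ-≺ {δ = d ∷ δ} _      _         (here a<c)      = here (+-monoʳ-< d a<c)
⊕-monoʳ-≺             base   top       (there u≺𝟎 _)   = ⊥-elim (¬≺𝟎 u≺𝟎)
⊕-monoʳ-≺             (0∷ z) (next z′) (there u≺w a<b) = there (⊕-monoʳ-≺ z z′ u≺w) a<b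

ω^-monoʳ-≺ : ∀ {a} → 0 < b → k < n → a < c → ω^[ k ]· a ≺[ b ] ω^[_]·_ {n} k c
ω^-monoʳ-≺ {k = zero}  {suc n} 0<b _         a<c = here a<c
ω^-monoʳ-≺ {k = suc k} {suc n} 0<b (s≤s k<n) a<c = there (ω^-monoʳ-≺ 0<b k<n a<c) 0<b

ω^-lower-≺ : ∀ {k′ c′} → k < k′ → k′ < n → c < b → 0 < c′ → ω^[ k ]· c ≺[ b ] ω^[_]·_ {n} k′ c′
ω^-lower-≺ {zero} {suc n} {b = b} {k′ = suc k′} {c′} _ (s≤s k′<n) c<b 0<c′ =
  there (subst (λ v → v ≺[ b ] ω^[ k′ ]· c′) (ω^-0 n k′) (ω^-monoʳ-≺ (≤-<-trans z≤n c<b) k′<n 0<c′)) c<b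
ω^-lower-≺ {suc k} {suc n} {k′ = suc k′} (s≤s k<k′) (s≤s k′<n) c<b 0<c′ =
  there (ω^-lower-≺ k<k′ k′<n c<b 0<c′) (≤-<-trans z≤n c<b)

⊕ω^-monoʳ-≼ : ∀ {δ : CNF n} {a} → ZeroBelow k δ → k < n → 0 < b → a ≤ c
            → δ ⊕ ω^[ k ]· a ≼[ b ] δ ⊕ ω^[ k ]· c
⊕ω^-monoʳ-≼ zb k<n 0<b a≤c with m≤n⇒m<n∨m≡n a≤c
... | inj₁ a<c  = [ ⊕-monoʳ-≺ zb (zeroAbove-ω^ ≤-refl) (ω^-monoʳ-≺ 0<b k<n a<c) ]
... | inj₂ refl = refl

⊕ω^-lower-≺ : ∀ {δ : CNF n} {k′ c′} → ZeroBelow k′ δ → k < k′ → k′ < n → c < b → 0 < c′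
            → δ ⊕ ω^[ k ]· c ≺[ b ] δ ⊕ ω^[ k′ ]· c′
⊕ω^-lower-≺ zb k<k′ k′<n c<b 0<c′ = ⊕-monoʳ-≺ zb (zeroAbove-ω^ ≤-refl) (ω^-lower-≺ k<k′ k′<n c<b 0<c′)

⊕ω^-exponent-≼ : ∀ {δ : CNF n} {k′} → ZeroBelow k′ δ → k ≤ k′ → k′ < n → c < b → 0 < c
               → δ ⊕ ω^[ k ]· c ≼[ b ] δ ⊕ ω^[ k′ ]· c
⊕ω^-exponent-≼ zb k≤k′ k′<n c<b 0<c with m≤n⇒m<n∨m≡n k≤k′
... | inj₁ k<k′ = [ ⊕ω^-lower-≺ zb k<k′ k′<n c<b 0<c ]
... | inj₂ refl = refl

-- Each copy of ω^(k+1) is expanded at some element x > y into ω^k·x, which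
-- dominates ω^k·(y+1).
large-expand : ∀ m (δ : CNF n) X → ZeroBelow (suc k) δ → suc k < n → AllPairs _<_ (y ∷ X)
             → Largeᶜ (δ ⊕ ω^[ suc k ]· m) X → Largeᶜ (δ ⊕ ω^[ k ]· (m * suc y)) X
large-expand {n} {k} zero δ X _ _ _ L =
  subst (λ v → Largeᶜ (δ ⊕ v) X) (trans (ω^-0 n (suc k)) (sym (ω^-0 n k))) L
large-expand (suc m) δ [] _ k<n _ L = ⊥-elim (ω^≢𝟎 k<n (u⊕v≡𝟎⇒v≡𝟎 δ _ L))
large-expand {k = k} {y = y} (suc m) δ (x ∷ X) zb k<n y<x∷X↑@((y<x ∷ _) ∷ x<X↑) L =
  large-⊆ (x ∷ʳ ⊆-refl) x<X↑
    (recombine (AllPairs-resp-⊆ (refl ∷ x ∷ʳ ⊆-refl) y<x∷X↑)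
      (split-large δ′ (ω^[ k ]· suc y) X zbδ′ (zeroAbove-ω^ ≤-refl) after-x))
  where
  δ′ = δ ⊕ ω^[ suc k ]· m

  zbδ′ : ZeroBelow k δ′
  zbδ′ = zeroBelow-⊕ω^ (zeroBelow-weaken (n≤1+n k) zb) (n≤1+n k)

  after-x : Largeᶜ (δ′ ⊕ ω^[ k ]· suc y) X
  after-x = large-≼ x<X↑ (⊕ω^-monoʳ-≼ zbδ′ (<-trans (n<1+n k) k<n) (s≤s z≤n) y<x)
              (subst (λ v → Largeᶜ v X) (fsᶜ-⊕ω^suc δ zb k<n) L)

  recombine : ∀ {Z} → AllPairs _<_ (y ∷ Z) → Split (ω^[ k ]· suc y) δ′ Z
            → Largeᶜ (δ ⊕ ω^[ k ]· (suc m * suc y)) Z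
  recombine y<Z (split {X₁ = X₁} {X₂} exact L₂) =
    subst (λ v → Largeᶜ v (X₁ ++ X₂)) eq
      (merge-large _ _ (zeroBelow-⊕ω^ (zeroBelow-weaken (n≤1+n k) zb) ≤-refl) (zeroAbove-ω^ ≤-refl) exact
        (large-expand m δ X₂ zb k<n (AllPairs-resp-⊆ (refl ∷ ++⁺ˡ X₁ ⊆-refl) y<Z) L₂))
    where
    eq : δ ⊕ ω^[ k ]· (m * suc y) ⊕ ω^[ k ]· suc y ≡ δ ⊕ ω^[ k ]· (suc m * suc y)
    eq = trans (sym (⊕ω^-+ δ k (m * suc y) (suc y)))
               (cong (λ e → δ ⊕ ω^[ k ]· e) (+-comm (m * suc y) (suc y)))

-- Intervals and sparse chains

range : ℕ → ℕ → List ℕ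
range x zero    = []
range x (suc k) = suc x ∷ range (suc x) k

applyUpTo-range : ∀ {f : ℕ → ℕ} x k → (∀ i → f i ≡ suc (x + i)) → applyUpTo f k ≡ range x k
applyUpTo-range x zero    f≗ = refl
applyUpTo-range x (suc k) f≗ =
  cong₂ _∷_ (trans (f≗ 0) (cong suc (+-identityʳ x)))
            (applyUpTo-range (suc x) k (λ i → trans (f≗ (suc i)) (cong suc (+-suc x i))))

interval≡range : ∀ x y → interval x y ≡ range x (y ∸ x)
interval≡range x y = trans (map-upTo (suc x +_) (y ∸ x)) (applyUpTo-range x (y ∸ x) (λ _ → refl))

range-++ : ∀ x a c → range x (a + c) ≡ range x a ++ range (x + a) c
range-++ x zero    c = cong (λ t → range t c) (sym (+-identityʳ x))
range-++ x (suc a) c =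
  cong (suc x ∷_) (trans (range-++ (suc x) a c)
                         (cong (λ t → range (suc x) a ++ range t c) (sym (+-suc x a))))

range-sorted : ∀ x k → AllPairs _<_ (x ∷ range x k)
range-sorted x zero    = [] ∷ []
range-sorted x (suc k) with range-sorted (suc x) k
... | sx<R ∷ R↑ = (≤-refl ∷ All.map (<-trans (n<1+n x)) sx<R) ∷ sx<R ∷ R↑

⊆-range : ∀ G → AllPairs _<_ (x ∷ G) → All (_≤ x + k) G → G ⊆ range x k
⊆-range         []      _                   _           = []⊆-universal _
⊆-range {x} {zero}  (g ∷ G) ((x<g ∷ _) ∷ _) (g≤x+0 ∷ _) =
  ⊥-elim (<⇒≱ x<g (subst (g ≤_) (+-identityʳ x) g≤x+0))
⊆-range {x} {suc k} (g ∷ G) ((x<g ∷ _) ∷ g<G ∷ G↑) g∷G≤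
  with m≤n⇒m<n∨m≡n x<g | All.map (λ g≤ → ≤-trans g≤ (≤-reflexive (+-suc x k))) g∷G≤
... | inj₂ refl | _ ∷ G≤ = refl ∷ ⊆-range G (g<G ∷ G↑) G≤
... | inj₁ sx<g | g∷G≤′  = suc x ∷ʳ ⊆-range (g ∷ G) ((sx<g ∷ All.map (<-trans sx<g) g<G) ∷ g<G ∷ G↑) g∷G≤′

≤-last : ∀ G → AllPairs _<_ (G ++ y ∷ []) → All (_≤ y) (G ++ y ∷ [])
≤-last []      _          = ≤-refl ∷ []
≤-last (g ∷ G) (g<G ∷ G↑) = <⇒≤ (proj₂ (∷ʳ⁻ g<G)) ∷ ≤-last G G↑

fsSet-O0 : ∀ X → fsSet O0 X ≡ O0
fsSet-O0 []      = refl
fsSet-O0 (x ∷ X) = fsSet-O0 X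

Large-++ : Large α A → Large α (A ++ B)
Large-++ {A = []}    {B} refl = fsSet-O0 B
Large-++ {A = x ∷ A}     L    = Large-++ {A = A} L

interval-extend : ∀ {y′} → Large α (interval x y) → y ≤ y′ → Large α (interval x y′)
interval-extend {α} {x} {y} {y′} L y≤y′ =
  subst (Large α) (sym (interval≡range x y′))
    (subst (λ t → Large α (range x t)) (m+[n∸m]≡n a≤a′)
      (subst (Large α) (sym (range-++ x a (a′ ∸ a)))
        (Large-++ {α} {range x a} (subst (Large α) (interval≡range x y) L))))
  where
  a  = y ∸ x
  a′ = y′ ∸ x
  a≤a′ : a ≤ a′
  a≤a′ = ∸-monoˡ-≤ x y≤y′

data Chain (α : Ord) : ℕ → List ℕ → ℕ → Set where
  []   : Chain α p [] p
  link : p < y → Large α (interval p y) → Chain α y Y q → Chain α p (y ∷ Y) q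

chain-++ : Chain α p Y q → Chain α q Y′ r → Chain α p (Y ++ Y′) r
chain-++ []              ch′ = ch′
chain-++ (link p<y L ch) ch′ = link p<y L (chain-++ ch ch′)

chain-≤ : Chain α p Y q → p ≤ q
chain-≤ []              = ≤-refl
chain-≤ (link p<y _ ch) = ≤-trans (<⇒≤ p<y) (chain-≤ ch)

chain-< : Chain α p Y q → All (p <_) Y
chain-< []              = []
chain-< (link p<y _ ch) = p<y ∷ All.map (<-trans p<y) (chain-< ch)

chain⇒sparse : Chain α p Y q → Sparse α (p ∷ Y)
chain⇒sparse ch _ _ (here refl) (here refl) x<y = ⊥-elim (<-irrefl refl x<y)
chain⇒sparse ch _ _ (there x∈Y) (here refl) x<p = ⊥-elim (<-asym x<p (All.lookup (chain-< ch) x∈Y))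
chain⇒sparse {α} {p} (link {y = y₁} _ L ch) _ _ (here refl) (there y∈Y) _ =
  interval-extend {α} {p} {y₁} L (first≤ y∈Y)
  where
  first≤ : y ∈ y₁ ∷ _ → y₁ ≤ y
  first≤ (here refl) = ≤-refl
  first≤ (there y∈)  = <⇒≤ (All.lookup (chain-< ch) y∈)
chain⇒sparse (link _ _ ch) x y (there x∈Y) (there y∈Y) x<y = chain⇒sparse ch x y x∈Y y∈Y x<y

-- Extracting sparse chains

ω²·3 : Ord
ω²·3 = ωmul (natO 2) 3

record Link (p : ℕ) (X : List ℕ) (δ : CNF N) : Set where
  field
    pivot        : ℕ
    rest         : List ℕ
    p<pivot      : p < pivot
    gap-large    : Large ω²·3 (interval p pivot)
    pivot∷rest⊆X : pivot ∷ rest ⊆ X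
    pivot<rest   : AllPairs _<_ (pivot ∷ rest)
    rest-large   : Largeᶜ δ rest

first-link : ∀ (δ : CNF N) → ZeroBelow 2 δ → 2 < N → AllPairs _<_ (p ∷ X)
           → Largeᶜ (δ ⊕ ω^[ 2 ]· 3) X → Link p X δ
first-link {X = X} δ zb 2<N p<X L with split-large δ (ω^[ 2 ]· 3) X zb (zeroAbove-ω^ ≤-refl) L
... | split {X₁ = G} exact L′ with initLast G
...   | [] = ⊥-elim (ω^≢𝟎 2<N (exact⇒large exact))
first-link {p = p} δ zb 2<N p<X L | split {X₂ = X′} exact L′ | G₀ ∷ʳ′ y = record
  { pivot        = y
  ; rest         = X′
  ; p<pivot      = p<y
  ; gap-large    = subst (λ α → Large α (interval p y)) (⟦ω^⟧ 2<N) (Largeᶜ⇒Large _ (interval p y) gap)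
  ; pivot∷rest⊆X = y∷X′⊆X
  ; pivot<rest   = AllPairs.tail p<y∷X′
  ; rest-large   = L′
  }
  where
  y∷X′⊆X : y ∷ X′ ⊆ (G₀ ++ y ∷ []) ++ X′
  y∷X′⊆X = subst (y ∷ X′ ⊆_) (sym (++-assoc G₀ (y ∷ []) X′)) (++⁺ˡ G₀ ⊆-refl)

  p<y∷X′ : AllPairs _<_ (p ∷ y ∷ X′)
  p<y∷X′ = AllPairs-resp-⊆ (refl ∷ y∷X′⊆X) p<X

  p<y : p < y
  p<y = All.head (AllPairs.head p<y∷X′)

  p<G : AllPairs _<_ (p ∷ G₀ ++ y ∷ [])
  p<G = AllPairs-resp-⊆ (refl ∷ ++⁺ʳ X′ ⊆-refl) p<X

  G⊆range : (G₀ ++ y ∷ []) ⊆ range p (y ∸ p)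
  G⊆range = ⊆-range (G₀ ++ y ∷ []) p<G
    (All.map (λ g≤y → subst (_ ≤_) (sym (m+[n∸m]≡n (<⇒≤ p<y))) g≤y) (≤-last G₀ (AllPairs.tail p<G)))

  gap : Largeᶜ (ω^[ 2 ]· 3) (interval p y)
  gap = subst (Largeᶜ _) (sym (interval≡range p y))
          (large-⊆ G⊆range (AllPairs.tail (range-sorted p (y ∸ p))) (exact⇒large exact))

record Extraction (p : ℕ) (X : List ℕ) (γ : CNF n) (δ : CNF N) : Set where
  field
    picked              : List ℕ
    remainder           : List ℕ
    last                : ℕ
    chain               : Chain ω²·3 p picked last
    exact               : ExactlyLarge γ picked
    picked++remainder⊆X : picked ++ remainder ⊆ X
    remainder-large     : Largeᶜ δ remainder
    last<remainder      : AllPairs _<_ (last ∷ remainder)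

open Extraction

extraction-[] : ∀ {δ : CNF N} → γ ≡ 𝟎 → AllPairs _<_ (p ∷ X) → Largeᶜ δ X → Extraction p X γ δ
extraction-[] {X = X} refl p<X L = record
  { picked = [] ; remainder = X ; last = _ ; chain = [] ; exact = done
  ; picked++remainder⊆X = ⊆-refl ; remainder-large = L ; last<remainder = p<X }

extraction-∷ : ∀ {δ δ′ : CNF N} (l : Link p X δ) → γ ≢ 𝟎
             → Extraction (Link.pivot l) (Link.rest l) (fsᶜ γ (Link.pivot l)) δ′
             → Extraction p X γ δ′
extraction-∷ l γ≢𝟎 E = record
  { picked              = Link.pivot l ∷ picked E
  ; remainder           = remainder E
  ; last                = last E
  ; chain               = link (Link.p<pivot l) (Link.gap-large l) (chain E)
  ; exact               = step γ≢𝟎 (exact E)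
  ; picked++remainder⊆X = ⊆-trans (refl ∷ picked++remainder⊆X E) (Link.pivot∷rest⊆X l)
  ; remainder-large     = remainder-large E
  ; last<remainder      = last<remainder E
  }

extraction-++ : ∀ {δ₁ δ₂ : CNF N} (γ₂ γ₁ : CNF n) → ZeroBelow k γ₂ → ZeroAbove k γ₁
              → (E : Extraction p X γ₁ δ₁) → Extraction (last E) (remainder E) γ₂ δ₂
              → Extraction p X (γ₂ ⊕ γ₁) δ₂
extraction-++ γ₂ γ₁ zb za E₁ E₂ = record
  { picked              = picked E₁ ++ picked E₂
  ; remainder           = remainder E₂
  ; last                = last E₂
  ; chain               = chain-++ (chain E₁) (chain E₂)
  ; exact               = exact-++ γ₂ γ₁ zb za (exact E₁) (exact E₂)
  ; picked++remainder⊆X =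
      subst (_⊆ _) (sym (++-assoc (picked E₁) (picked E₂) (remainder E₂)))
        (⊆-trans (++⁺ ⊆-refl (picked++remainder⊆X E₂)) (picked++remainder⊆X E₁))
  ; remainder-large     = remainder-large E₂
  ; last<remainder      = last<remainder E₂
  }

extract₀ : ∀ c (δ : CNF N) → ZeroBelow 2 δ → 2 < N → AllPairs _<_ (p ∷ X)
         → Largeᶜ (δ ⊕ ω^[ 2 ]· (3 * c)) X → Extraction p X (ω^[_]·_ {suc n} 0 c) δ
extract₀ {N} {X = X} zero δ _ _ p<X L =
  extraction-[] refl p<X (subst (λ v → Largeᶜ v X) (trans (cong (δ ⊕_) (ω^-0 N 2)) (⊕-identityʳ δ)) L)
extract₀ {X = X} (suc c) δ zb 2<N p<X L =
  extraction-∷ l (λ ()) (extract₀ c δ zb 2<N (Link.pivot<rest l) (Link.rest-large l))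
  where
  l = first-link (δ ⊕ ω^[ 2 ]· (3 * c)) (zeroBelow-⊕ω^ zb ≤-refl) 2<N p<X
        (subst (λ v → Largeᶜ v X) (⊕ω^-3*suc δ 2 c) L)

extract : ∀ j c (δ : CNF N) → ZeroBelow (2 + j) δ → 2 + j < N → j < n → 3 ≤ p → AllPairs _<_ (p ∷ X)
        → Largeᶜ (δ ⊕ ω^[ 2 + j ]· (3 * c) ⊕ ω^[ 2 ]· 3) X
        → Extraction p X (ω^[_]·_ {n} j c) (δ ⊕ ω^[ 2 ]· 3)
extract {n = suc n} {X = X} zero c δ zb 2<N _ _ p<X L =
  extract₀ c (δ ⊕ ω^[ 2 ]· 3) (zeroBelow-⊕ω^ zb ≤-refl) 2<N p<X
    (subst (λ v → Largeᶜ v X) (⊕-right-comm δ _ _) L)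
extract {N} {n} {X = X} (suc j) zero δ zb _ _ _ p<X L =
  extraction-[] (ω^-0 n (suc j)) p<X
    (subst (λ v → Largeᶜ (v ⊕ ω^[ 2 ]· 3) X) (trans (cong (δ ⊕_) (ω^-0 N (3 + j))) (⊕-identityʳ δ)) L)
extract {N} {p = p} {X} (suc j) (suc c) δ zb 3+j<N j+1<n 3≤p p<X L =
  let E₁ = extract j y₁ δ₁ zbδ₁ 2+j<N (<-trans (n<1+n j) j+1<n) 3≤y₁ (Link.pivot<rest l) rest-large
      E₂ = extract (suc j) c δ zb 3+j<N j+1<n (≤-trans 3≤y₁ (chain-≤ (chain E₁)))
             (last<remainder E₁) (remainder-large E₁)
  in extraction-∷ l (ω^≢𝟎 j+1<n)
       (subst (λ γ → Extraction y₁ (Link.rest l) γ _) (sym (fsᶜ-ω^suc j+1<n))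
         (extraction-++ (ω^[ suc j ]· c) (ω^[ j ]· y₁) (zeroBelow-ω^ (n≤1+n j)) (zeroAbove-ω^ ≤-refl)
           E₁ E₂))
  where
  2+j<N : 2 + j < N
  2+j<N = <-trans (n<1+n _) 3+j<N

  l : Link p X (δ ⊕ ω^[ 3 + j ]· (3 * suc c))
  l = first-link _ (zeroBelow-⊕ω^ (zeroBelow-weaken (m≤m+n 2 (suc j)) zb) (m≤m+n 2 (suc j)))
        (≤-trans (m≤m+n 3 j) (<⇒≤ 3+j<N)) p<X L

  y₁ = Link.pivot l
  δ₁ = δ ⊕ ω^[ 3 + j ]· (3 * c)

  3≤y₁ : 3 ≤ y₁
  3≤y₁ = ≤-trans 3≤p (<⇒≤ (Link.p<pivot l))

  zbδ₁ : ZeroBelow (2 + j) δ₁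
  zbδ₁ = zeroBelow-⊕ω^ (zeroBelow-weaken (n≤1+n _) zb) (n≤1+n _)

  budget : Largeᶜ (δ₁ ⊕ ω^[ 3 + j ]· 3) (Link.rest l)
  budget = subst (λ v → Largeᶜ v (Link.rest l)) (⊕ω^-3*suc δ (3 + j) c) (Link.rest-large l)

  expanded : Largeᶜ (δ₁ ⊕ ω^[ 2 + j ]· (3 * y₁) ⊕ ω^[ 2 + j ]· 3) (Link.rest l)
  expanded = subst (λ v → Largeᶜ v (Link.rest l)) (⊕ω^-3*suc δ₁ (2 + j) y₁)
    (large-expand 3 δ₁ (Link.rest l) (zeroBelow-⊕ω^ zb ≤-refl) 3+j<N (Link.pivot<rest l) budget)

  rest-large : Largeᶜ (δ₁ ⊕ ω^[ 2 + j ]· (3 * y₁) ⊕ ω^[ 2 ]· 3) (Link.rest l)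
  rest-large = large-≼ (Link.pivot<rest l)
    (⊕ω^-exponent-≼ (zeroBelow-⊕ω^ zbδ₁ ≤-refl) (m≤m+n 2 j) 2+j<N (s≤s 3≤y₁) (s≤s z≤n)) expanded

-- For m = 0 the budget ω²·x may be as small as ω²·(3ℓ+1), too little for the
-- trailing ω²·3 of extract, so extract₀ is used directly.
main-extraction : ∀ m {ℓ} → 3 * ℓ < x → 3 ≤ x → AllPairs _<_ (x ∷ X)
                → Largeᶜ (ω^[_]·_ {3 + m} (2 + m) x) X
                → Σ (CNF (3 + m)) (Extraction x X (ω^[_]·_ {suc m} m ℓ))
main-extraction {x} {X} zero {ℓ} 3ℓ<x _ x<X L =
  𝟎 , extract₀ ℓ 𝟎 (zeroBelow-𝟎 3 2) ≤-refl x<X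
        (large-≼ x<X (⊕ω^-monoʳ-≼ (zeroBelow-𝟎 3 2) ≤-refl (s≤s z≤n) (<⇒≤ 3ℓ<x))
          (subst (λ v → Largeᶜ v X) (sym (⊕-identityˡ _)) L))
main-extraction {x} {X} (suc m) {ℓ} 3ℓ<x 3≤x x<X L =
  𝟎 ⊕ ω^[ 2 ]· 3 , extract (suc m) ℓ 𝟎 (zeroBelow-𝟎 _ _) ≤-refl ≤-refl 3≤x x<X
    (large-≼ x<X [ ⊕ω^-lower-≺ (zeroBelow-⊕ω^ (zeroBelow-𝟎 _ _) ≤-refl) (s≤s (s≤s (s≤s z≤n))) ≤-refl
                                (s≤s 3≤x) (m<n⇒0<n∸m 3ℓ<x) ]
      (subst (λ v → Largeᶜ v X) split-x L))
  where
  split-x : ω^[ 3 + m ]· x ≡ 𝟎 ⊕ ω^[ 3 + m ]· (3 * ℓ) ⊕ ω^[ 3 + m ]· (x ∸ 3 * ℓ)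
  split-x = begin
    ω^[ 3 + m ]· x                                      ≡⟨ cong (ω^[ 3 + m ]·_) (m+[n∸m]≡n (<⇒≤ 3ℓ<x)) ⟨
    ω^[ 3 + m ]· (3 * ℓ + (x ∸ 3 * ℓ))                  ≡⟨ ⊕-identityˡ _ ⟨
    𝟎 ⊕ ω^[ 3 + m ]· (3 * ℓ + (x ∸ 3 * ℓ))              ≡⟨ ⊕ω^-+ 𝟎 (3 + m) (3 * ℓ) (x ∸ 3 * ℓ) ⟩
    𝟎 ⊕ ω^[ 3 + m ]· (3 * ℓ) ⊕ ω^[ 3 + m ]· (x ∸ 3 * ℓ) ∎

sparse-large-subset : ∀ {m ℓ} {δ : CNF N} → Extraction x X (ω^[_]·_ {suc m} m ℓ) δ
  → Σ (List ℕ) (λ Y → Y ⊆ x ∷ X × Sparse ω²·3 Y × Large (ωmul (natO m) ℓ ⊕ω^ O0) Y)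
sparse-large-subset {x = x} E =
  x ∷ picked E ,
  refl ∷ ⊆-trans (++⁺ʳ (remainder E) ⊆-refl) (picked++remainder⊆X E) ,
  chain⇒sparse (chain E) ,
  subst (λ α → Large α (picked E)) (⟦ω^⟧ ≤-refl) (Largeᶜ⇒Large _ (picked E) (exact⇒large (exact E)))

mainTheorem18 : (ℓ m : ℕ) → 1 ≤ ℓ → (X : List ℕ) → AllPairs _<_ X →
    Large (ω^ (natO (m + 3))) X → All (λ x → 3 * ℓ + 2 ≤ x) X →
    Σ (List ℕ) (λ Y → Y ⊆ X × Sparse (ωmul (natO 2) 3) Y
      × Large (ωmul (natO m) ℓ ⊕ω^ O0) Y)
mainTheorem18 ℓ m 1≤ℓ []      _      ()  _
mainTheorem18 ℓ m 1≤ℓ (x ∷ X) x<X∷X↑ L (3ℓ+2≤x ∷ _) =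
  sparse-large-subset (proj₂ (main-extraction m 3ℓ<x 3≤x x<X∷X↑ X-large))
  where
  3ℓ<x : 3 * ℓ < x
  3ℓ<x = <-≤-trans (m<m+n (3 * ℓ) (s≤s z≤n)) 3ℓ+2≤x

  3≤x : 3 ≤ x
  3≤x = ≤-trans (*-monoʳ-≤ 3 1≤ℓ) (<⇒≤ 3ℓ<x)

  X-large : Largeᶜ (ω^[ 2 + m ]· x) X
  X-large = Large-ω^suc⇒Largeᶜ x X ≤-refl (subst (λ e → Large (ω^ (natO e)) (x ∷ X)) (+-comm m 3) L)
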